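{- Let $G=(V,E)$ be a simple undirected graph with $n=|V|$ nodes and $n\times n$ adjacency matrix $A_G$ (zero diagonal), and let $k\ge 1$. For a partition $\mathcal{P}$ of $V$ into $k$ nonempty blocks (supernodes) and blocks $U,W\in\mathcal{P}$ (possibly $U=W$), put $\alpha_{UW}=\frac{1}{|U||W|}\sum_{u\in U,\,w\in W}A_G(u,w)$. Define the $l_1$ reconstruction error $$RE_1(\mathcal{P})=\sum_{u\in V}\sum_{w\in V}\bigl|A_G(u,w)-\alpha_{U(u)W(w)}\bigr|,$$ where $U(u)$ denotes the block containing $u$, and the correction-list size $$C(\mathcal{P})=\frac12\sum_{(U,W)\in\mathcal{P}\times\mathcal{P}}|U||W|\cdot\begin{cases}1-\alpha_{UW}, & \alpha_{UW}>0.5,\\ \alpha_{UW}, & \text{otherwise.}\end{cases}$$ Let $\mathcal{P}^+$ be a partition into $k$ blocks minimizing $RE_1$, and let $\mathcal{P}^*$ be a partition into $k$ blocks minimizing $C$. Then $C(\mathcal{P}^+)\le 2\,C(\mathcal{P}^*)$.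
   Context: A lossless summary of $G$ given by a partition $\mathcal{P}$ of $V$ into supernodes keeps a superedge between supernodes $U,W$ exactly when the edge density $\alpha_{UW}>0.5$; the correction edges are the edges to be added or removed to reconstruct $G$ exactly, and their number is $C(\mathcal{P})$ as defined. A $k$-summary is a summary with exactly $k$ supernodes. -}

module Defs where

open import Data.Nat as ℕ using (ℕ; zero; suc)
open import Data.Fin using (Fin; zero; suc)
open import Data.Fin.Properties using (_≟_)
open import Data.Bool using (Bool; true; false; if_then_else_)
open import Data.Integer using (+_)
open import Data.Rational using (ℚ; 0ℚ; 1ℚ; ½; _+_; _-_; _*_; _/_; ∣_∣; _<?_)
open import Data.Product using (∃)
open import Relation.Binary.PropositionalEquality using (_≡_)
open import Relation.Nullary using (¬_; yes; no)

record SimpleGraph (n : ℕ) : Set where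
  field
    adj     : Fin n → Fin n → Bool
    sym     : ∀ u w → adj u w ≡ adj w u
    irrefl  : ∀ u → adj u u ≡ false

open SimpleGraph public

A : ∀ {n} → SimpleGraph n → Fin n → Fin n → ℚ
A G u w = if adj G u w then 1ℚ else 0ℚ

Σℚ : ∀ n → (Fin n → ℚ) → ℚ
Σℚ zero    f = 0ℚ
Σℚ (suc n) f = f zero + Σℚ n (λ i → f (suc i))

Σℕ : ∀ n → (Fin n → ℕ) → ℕ
Σℕ zero    f = 0
Σℕ (suc n) f = f zero ℕ.+ Σℕ n (λ i → f (suc i))

-- A partition of V = Fin n into k nonempty blocks is represented by a
-- surjective labelling p : Fin n → Fin k (block U = p⁻¹(U)).
IsKPartition : ∀ {n k} → (Fin n → Fin k) → Set
IsKPartition {n} {k} p = ∀ (U : Fin k) → ∃ λ (u : Fin n) → p u ≡ U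

ind : ∀ {n k} → (Fin n → Fin k) → Fin n → Fin k → ℕ
ind p u U with p u ≟ U
... | yes _ = 1
... | no  _ = 0

blockSize : ∀ {n k} → (Fin n → Fin k) → Fin k → ℕ
blockSize {n} p U = Σℕ n (λ u → ind p u U)

-- m / d as a rational; d = 0 never occurs for blocks of a partition
-- (blocks are nonempty), the value 0 in that case is a junk value.
divℕ : ℕ → ℕ → ℚ
divℕ m zero    = 0ℚ
divℕ m (suc d) = (+ m) / suc d

edgeSum : ∀ {n k} → SimpleGraph n → (Fin n → Fin k) → Fin k → Fin k → ℕ
edgeSum {n} G p U W =
  Σℕ n (λ u → Σℕ n (λ w → ind p u U ℕ.* ind p w W ℕ.* (if adj G u w then 1 else 0)))

α : ∀ {n k} → SimpleGraph n → (Fin n → Fin k) → Fin k → Fin k → ℚ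
α G p U W = divℕ (edgeSum G p U W) (blockSize p U ℕ.* blockSize p W)

RE₁ : ∀ {n k} → SimpleGraph n → (Fin n → Fin k) → ℚ
RE₁ {n} G p = Σℚ n (λ u → Σℚ n (λ w → ∣ A G u w - α G p (p u) (p w) ∣))

cost : ℚ → ℚ
cost a with ½ <? a
... | yes _ = 1ℚ - a
... | no  _ = a

C : ∀ {n k} → SimpleGraph n → (Fin n → Fin k) → ℚ
C {n} {k} G p =
  ½ * Σℚ k (λ U → Σℚ k (λ W →
        ((+ (blockSize p U ℕ.* blockSize p W)) / 1) * cost (α G p U W)))

module Submission where

-- A block pair (U, W) with m = |U||W| cells and density α holds mα ones, so it
-- contributes m · 2α(1 − α) to RE₁ and m · min(α, 1 − α) to 2C.  On [0, 1],
-- min(α, 1 − α) ≤ 2α(1 − α) ≤ 2 min(α, 1 − α); summing over block pairs gives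
-- 2C(P) ≤ RE₁(P) ≤ 4C(P) for every P, hence
-- 2C(P⁺) ≤ RE₁(P⁺) ≤ RE₁(P*) ≤ 4C(P*).

open import Defs hiding (sym)
open import Data.Nat as ℕ using (ℕ; zero; suc; _≥_)
open import Data.Fin using (Fin; zero; suc)
open import Data.Fin.Properties using (_≟_)
open import Data.Bool using (Bool; true; false; if_then_else_)
open import Data.Integer as ℤ using (+_)
import Data.Integer.Properties as ℤ
open import Data.Rational using (ℚ; 0ℚ; 1ℚ; ½; _+_; _-_; _*_; _/_; ∣_∣; _<?_; _≤_; -_; fromℚᵘ; Positive; nonNegative)
open import Data.Rational.Properties hiding (_≟_)
import Data.Rational.Unnormalised as ℚᵘ
import Data.Rational.Unnormalised.Properties as ℚᵘ
open import Data.Rational.Solver using (module +-*-Solver)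
open import Data.Product using (_,_; _×_; proj₁; proj₂)
open import Relation.Nullary using (yes; no; ¬_; contradiction)
open import Relation.Binary.PropositionalEquality

fromℚᵘ-homo-+ : ∀ p q → fromℚᵘ (p ℚᵘ.+ q) ≡ fromℚᵘ p + fromℚᵘ q
fromℚᵘ-homo-+ p q = trans
  (fromℚᵘ-cong (ℚᵘ.≃-trans
    (ℚᵘ.+-cong (ℚᵘ.≃-sym (toℚᵘ-fromℚᵘ p)) (ℚᵘ.≃-sym (toℚᵘ-fromℚᵘ q)))
    (ℚᵘ.≃-sym (toℚᵘ-homo-+ (fromℚᵘ p) (fromℚᵘ q)))))
  (fromℚᵘ-toℚᵘ _)

fromℚᵘ-homo-* : ∀ p q → fromℚᵘ (p ℚᵘ.* q) ≡ fromℚᵘ p * fromℚᵘ q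
fromℚᵘ-homo-* p q = trans
  (fromℚᵘ-cong (ℚᵘ.≃-trans
    (ℚᵘ.*-cong (ℚᵘ.≃-sym (toℚᵘ-fromℚᵘ p)) (ℚᵘ.≃-sym (toℚᵘ-fromℚᵘ q)))
    (ℚᵘ.≃-sym (toℚᵘ-homo-* (fromℚᵘ p) (fromℚᵘ q)))))
  (fromℚᵘ-toℚᵘ _)

-- (+ m) / 1 is definitionally fromℚᵘ (+ m ℚᵘ./ 1), so arithmetic on fromℕ reduces to ℤ.
fromℕ : ℕ → ℚ
fromℕ m = (+ m) / 1

fromℕ-+ : ∀ a b → fromℕ (a ℕ.+ b) ≡ fromℕ a + fromℕ b
fromℕ-+ a b =
  trans (fromℚᵘ-cong {+ (a ℕ.+ b) ℚᵘ./ 1} {a′ ℚᵘ.+ b′} (ℚᵘ.*≡* eq)) (fromℚᵘ-homo-+ a′ b′)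
  where
  a′ b′ : ℚᵘ.ℚᵘ
  a′ = + a ℚᵘ./ 1
  b′ = + b ℚᵘ./ 1
  eq : + (a ℕ.+ b) ℤ.* + 1 ≡ (+ a ℤ.* + 1 ℤ.+ + b ℤ.* + 1) ℤ.* + 1
  eq = cong (ℤ._* + 1) (trans (ℤ.pos-+ a b)
         (sym (cong₂ ℤ._+_ (ℤ.*-identityʳ (+ a)) (ℤ.*-identityʳ (+ b)))))

fromℕ-* : ∀ a b → fromℕ (a ℕ.* b) ≡ fromℕ a * fromℕ b
fromℕ-* a b =
  trans (fromℚᵘ-cong {+ (a ℕ.* b) ℚᵘ./ 1} {a′ ℚᵘ.* b′} (ℚᵘ.*≡* eq)) (fromℚᵘ-homo-* a′ b′)
  where
  a′ b′ : ℚᵘ.ℚᵘ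
  a′ = + a ℚᵘ./ 1
  b′ = + b ℚᵘ./ 1
  eq : + (a ℕ.* b) ℤ.* + 1 ≡ (+ a ℤ.* + b) ℤ.* + 1
  eq = cong (ℤ._* + 1) (ℤ.pos-* a b)

fromℕ-nonNeg : ∀ m → 0ℚ ≤ fromℕ m
fromℕ-nonNeg m = nonNegative⁻¹ (fromℕ m) {{normalize-nonNeg m 1}}

fromℕ-indicator : ∀ b → fromℕ (if b then 1 else 0) ≡ (if b then 1ℚ else 0ℚ)
fromℕ-indicator true  = refl
fromℕ-indicator false = refl

-- For m = 0 the hypothesis forces e = 0, so the junk value divℕ e 0 = 0 is harmless.
divℕ-inverse : ∀ e m → fromℕ e ≤ fromℕ m → fromℕ m * divℕ e m ≡ fromℕ e
divℕ-inverse e zero e≤0 = trans (*-zeroʳ 0ℚ) (≤-antisym (fromℕ-nonNeg e) e≤0)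
divℕ-inverse e (suc d) _ =
  trans (sym (fromℚᵘ-homo-* (+ suc d ℚᵘ./ 1) (ℚᵘ.mkℚᵘ (+ e) d)))
        (fromℚᵘ-cong {(+ suc d ℚᵘ./ 1) ℚᵘ.* ℚᵘ.mkℚᵘ (+ e) d} {+ e ℚᵘ./ 1} (ℚᵘ.*≡* eq))
  where
  eq : (+ suc d ℤ.* + e) ℤ.* + 1 ≡ + e ℤ.* (+ 1 ℤ.* + suc d)
  eq = trans (ℤ.*-identityʳ _) (trans (ℤ.*-comm (+ suc d) (+ e))
         (cong (+ e ℤ.*_) (sym (ℤ.*-identityˡ _))))

divℕ-unitInterval : ∀ e m → fromℕ e ≤ fromℕ m → 0ℚ ≤ divℕ e m × divℕ e m ≤ 1ℚ
divℕ-unitInterval e zero _ = ≤-refl , ≤ᵇ⇒≤ _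
divℕ-unitInterval e m@(suc _) e≤m =
  *-cancelˡ-≤-pos (fromℕ m) (subst₂ _≤_ (sym (*-zeroʳ (fromℕ m))) (sym m*x≡e) (fromℕ-nonNeg e)) ,
  *-cancelˡ-≤-pos (fromℕ m) (subst₂ _≤_ (sym m*x≡e) (sym (*-identityʳ (fromℕ m))) e≤m)
  where
  instance
    m-pos : Positive (fromℕ m)
    m-pos = normalize-pos m 1
  m*x≡e : fromℕ m * divℕ e m ≡ fromℕ e
  m*x≡e = divℕ-inverse e m e≤m

Σ-cong : ∀ n {f g : Fin n → ℚ} → (∀ i → f i ≡ g i) → Σℚ n f ≡ Σℚ n g
Σ-cong zero    f≡g = refl
Σ-cong (suc n) f≡g = cong₂ _+_ (f≡g zero) (Σ-cong n (λ i → f≡g (suc i)))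

Σ-zero : ∀ n → Σℚ n (λ _ → 0ℚ) ≡ 0ℚ
Σ-zero zero    = refl
Σ-zero (suc n) = trans (+-identityˡ _) (Σ-zero n)

Σ-distrib-+ : ∀ n (f g : Fin n → ℚ) → Σℚ n (λ i → f i + g i) ≡ Σℚ n f + Σℚ n g
Σ-distrib-+ zero    f g = sym (+-identityˡ 0ℚ)
Σ-distrib-+ (suc n) f g =
  trans (cong (_+_ (f zero + g zero)) (Σ-distrib-+ n _ _)) (interchange (f zero) (g zero) _ _)
  where
  open +-*-Solver
  interchange : ∀ a b c d → (a + b) + (c + d) ≡ (a + c) + (b + d)
  interchange = solve 4 (λ a b c d → (a :+ b) :+ (c :+ d) := (a :+ c) :+ (b :+ d)) refl

*-distribˡ-Σ : ∀ n c (f : Fin n → ℚ) → c * Σℚ n f ≡ Σℚ n (λ i → c * f i)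
*-distribˡ-Σ zero    c f = *-zeroʳ c
*-distribˡ-Σ (suc n) c f = trans (*-distribˡ-+ c _ _) (cong (_+_ (c * f zero)) (*-distribˡ-Σ n c _))

*-distribʳ-Σ : ∀ n c (f : Fin n → ℚ) → Σℚ n f * c ≡ Σℚ n (λ i → f i * c)
*-distribʳ-Σ n c f =
  trans (*-comm _ c) (trans (*-distribˡ-Σ n c f) (Σ-cong n (λ i → *-comm c (f i))))

Σ-comm : ∀ n k (F : Fin n → Fin k → ℚ) →
         Σℚ n (λ i → Σℚ k (F i)) ≡ Σℚ k (λ j → Σℚ n (λ i → F i j))
Σ-comm zero    k F = sym (Σ-zero k)
Σ-comm (suc n) k F =
  trans (cong (_+_ (Σℚ k (F zero))) (Σ-comm n k (λ i → F (suc i)))) (sym (Σ-distrib-+ k _ _))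

Σ-mono-≤ : ∀ n {f g : Fin n → ℚ} → (∀ i → f i ≤ g i) → Σℚ n f ≤ Σℚ n g
Σ-mono-≤ zero    f≤g = ≤-refl
Σ-mono-≤ (suc n) f≤g = +-mono-≤ (f≤g zero) (Σ-mono-≤ n (λ i → f≤g (suc i)))

fromℕ-Σ : ∀ n (f : Fin n → ℕ) → fromℕ (Σℕ n f) ≡ Σℚ n (λ i → fromℕ (f i))
fromℕ-Σ zero    f = refl
fromℕ-Σ (suc n) f = trans (fromℕ-+ (f zero) _) (cong (_+_ (fromℕ (f zero))) (fromℕ-Σ n _))

δ : ∀ {k} → Fin k → Fin k → ℚ
δ zero    zero    = 1ℚ
δ zero    (suc _) = 0ℚ
δ (suc _) zero    = 0ℚ
δ (suc i) (suc j) = δ i j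

δ-nonNeg : ∀ {k} (i j : Fin k) → 0ℚ ≤ δ i j
δ-nonNeg zero    zero    = ≤ᵇ⇒≤ _
δ-nonNeg zero    (suc _) = ≤-refl
δ-nonNeg (suc _) zero    = ≤-refl
δ-nonNeg (suc i) (suc j) = δ-nonNeg i j

δ-refl : ∀ {k} (i : Fin k) → δ i i ≡ 1ℚ
δ-refl zero    = refl
δ-refl (suc i) = δ-refl i

δ-≢ : ∀ {k} {i j : Fin k} → ¬ i ≡ j → δ i j ≡ 0ℚ
δ-≢ {i = zero}  {zero}  i≢j = contradiction refl i≢j
δ-≢ {i = zero}  {suc _} _   = refl
δ-≢ {i = suc _} {zero}  _   = refl
δ-≢ {i = suc i} {suc j} i≢j = δ-≢ (λ i≡j → i≢j (cong suc i≡j))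

Σ-δ : ∀ k (i : Fin k) (f : Fin k → ℚ) → Σℚ k (λ j → δ i j * f j) ≡ f i
Σ-δ (suc k) zero f = begin
  1ℚ * f zero + Σℚ k (λ j → 0ℚ * f (suc j))
    ≡⟨ cong₂ _+_ (*-identityˡ (f zero)) (Σ-cong k (λ j → *-zeroˡ (f (suc j)))) ⟩
  f zero + Σℚ k (λ _ → 0ℚ)
    ≡⟨ cong (_+_ (f zero)) (Σ-zero k) ⟩
  f zero + 0ℚ
    ≡⟨ +-identityʳ _ ⟩
  f zero
    ∎
  where open ≡-Reasoning
Σ-δ (suc k) (suc i) f =
  trans (cong (_+ Σℚ k (λ j → δ i j * f (suc j))) (*-zeroˡ (f zero)))
        (trans (+-identityˡ _) (Σ-δ k i (λ j → f (suc j))))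

p≤q⇒0≤q-p : ∀ {p q} → p ≤ q → 0ℚ ≤ q - p
p≤q⇒0≤q-p {p} {q} p≤q = subst (_≤ q - p) (+-inverseʳ p) (+-monoˡ-≤ (- p) p≤q)

0≤q-p⇒p≤q : ∀ {p q} → 0ℚ ≤ q - p → p ≤ q
0≤q-p⇒p≤q {p} {q} 0≤q-p = subst₂ _≤_ (+-identityʳ p) (p+[q-p]≡q p q) (+-monoʳ-≤ p 0≤q-p)
  where
  open +-*-Solver
  p+[q-p]≡q : ∀ p q → p + (q - p) ≡ q
  p+[q-p]≡q = solve 2 (λ p q → p :+ (q :- p) := q) refl

0≤p⇒0≤q⇒0≤p*q : ∀ {p q} → 0ℚ ≤ p → 0ℚ ≤ q → 0ℚ ≤ p * q
0≤p⇒0≤q⇒0≤p*q {p} {q} 0≤p 0≤q =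
  nonNegative⁻¹ (p * q) {{nonNeg*nonNeg⇒nonNeg p {{nonNegative 0≤p}} q {{nonNegative 0≤q}}}}

gini : ℚ → ℚ
gini x = (x + x) * (1ℚ - x)

cost≤gini : ∀ {x} → 0ℚ ≤ x → x ≤ 1ℚ → cost x ≤ gini x
cost≤gini {x} 0≤x x≤1 with ½ <? x
... | yes ½<x = 0≤q-p⇒p≤q (subst (0ℚ ≤_) (eq x)
      (0≤p⇒0≤q⇒0≤p*q (p≤q⇒0≤q-p x≤1) (+-mono-≤ 0≤x-½ 0≤x-½)))
  where
  open +-*-Solver
  0≤x-½ : 0ℚ ≤ x - ½
  0≤x-½ = p≤q⇒0≤q-p (<⇒≤ ½<x)
  eq : ∀ x → (1ℚ - x) * ((x - ½) + (x - ½)) ≡ gini x - (1ℚ - x)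
  eq = solve 1 (λ x → (con 1ℚ :- x) :* ((x :- con ½) :+ (x :- con ½))
                      := (x :+ x) :* (con 1ℚ :- x) :- (con 1ℚ :- x)) refl
... | no  ½≮x = 0≤q-p⇒p≤q (subst (0ℚ ≤_) (eq x)
      (0≤p⇒0≤q⇒0≤p*q 0≤x (+-mono-≤ 0≤½-x 0≤½-x)))
  where
  open +-*-Solver
  0≤½-x : 0ℚ ≤ ½ - x
  0≤½-x = p≤q⇒0≤q-p (≮⇒≥ ½≮x)
  eq : ∀ x → x * ((½ - x) + (½ - x)) ≡ gini x - x
  eq = solve 1 (λ x → x :* ((con ½ :- x) :+ (con ½ :- x)) := (x :+ x) :* (con 1ℚ :- x) :- x) refl

gini≤2cost : ∀ {x} → 0ℚ ≤ x → x ≤ 1ℚ → gini x ≤ cost x + cost x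
gini≤2cost {x} 0≤x x≤1 with ½ <? x
... | yes _ = 0≤q-p⇒p≤q (subst (0ℚ ≤_) (eq x)
      (0≤p⇒0≤q⇒0≤p*q (+-mono-≤ 0≤1-x 0≤1-x) 0≤1-x))
  where
  open +-*-Solver
  0≤1-x : 0ℚ ≤ 1ℚ - x
  0≤1-x = p≤q⇒0≤q-p x≤1
  eq : ∀ x → ((1ℚ - x) + (1ℚ - x)) * (1ℚ - x) ≡ ((1ℚ - x) + (1ℚ - x)) - gini x
  eq = solve 1 (λ x → ((con 1ℚ :- x) :+ (con 1ℚ :- x)) :* (con 1ℚ :- x)
                      := ((con 1ℚ :- x) :+ (con 1ℚ :- x)) :- (x :+ x) :* (con 1ℚ :- x)) refl
... | no  _ = 0≤q-p⇒p≤q (subst (0ℚ ≤_) (eq x)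
      (0≤p⇒0≤q⇒0≤p*q (+-mono-≤ 0≤x 0≤x) 0≤x))
  where
  open +-*-Solver
  eq : ∀ x → (x + x) * x ≡ (x + x) - gini x
  eq = solve 1 (λ x → (x :+ x) :* x := (x :+ x) :- (x :+ x) :* (con 1ℚ :- x)) refl

indicator≤1 : ∀ b → (if b then 1ℚ else 0ℚ) ≤ 1ℚ
indicator≤1 true  = ≤-refl
indicator≤1 false = ≤ᵇ⇒≤ _

∣indicator-x∣ : ∀ (b : Bool) {x} → 0ℚ ≤ x → x ≤ 1ℚ →
                ∣ (if b then 1ℚ else 0ℚ) - x ∣ ≡ x + (if b then 1ℚ else 0ℚ) * (1ℚ - x - x)
∣indicator-x∣ true  {x} _   x≤1 = trans (0≤p⇒∣p∣≡p (p≤q⇒0≤q-p x≤1)) (eq x)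
  where
  open +-*-Solver
  eq : ∀ x → 1ℚ - x ≡ x + 1ℚ * (1ℚ - x - x)
  eq = solve 1 (λ x → con 1ℚ :- x := x :+ con 1ℚ :* (con 1ℚ :- x :- x)) refl
∣indicator-x∣ false {x} 0≤x _   = begin
  ∣ 0ℚ - x ∣                ≡⟨ cong ∣_∣ (+-identityˡ (- x)) ⟩
  ∣ - x ∣                   ≡⟨ ∣-p∣≡∣p∣ x ⟩
  ∣ x ∣                     ≡⟨ 0≤p⇒∣p∣≡p 0≤x ⟩
  x                         ≡⟨ sym (+-identityʳ x) ⟩
  x + 0ℚ                    ≡⟨ cong (_+_ x) (sym (*-zeroˡ (1ℚ - x - x))) ⟩
  x + 0ℚ * (1ℚ - x - x)     ∎
  where open ≡-Reasoning

module Blocks {n k : ℕ} (p : Fin n → Fin k) where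

  blockΣ : Fin k → Fin k → (Fin n → Fin n → ℚ) → ℚ
  blockΣ U W F = Σℚ n (λ u → Σℚ n (λ w → (δ (p u) U * δ (p w) W) * F u w))

  fromℕ-ind : ∀ u U → fromℕ (ind p u U) ≡ δ (p u) U
  fromℕ-ind u U with p u ≟ U
  ... | yes pu≡U = sym (trans (cong (λ V → δ V U) pu≡U) (δ-refl U))
  ... | no  pu≢U = sym (δ-≢ pu≢U)

  Σ-by-blocks : ∀ (F : Fin n → Fin n → Fin k → Fin k → ℚ) →
                Σℚ n (λ u → Σℚ n (λ w → F u w (p u) (p w))) ≡
                Σℚ k (λ U → Σℚ k (λ W → blockΣ U W (λ u w → F u w U W)))
  Σ-by-blocks F = begin
    Σℚ n (λ u → Σℚ n (λ w → F u w (p u) (p w)))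
      ≡⟨ Σ-cong n (λ u → Σ-cong n (λ w → select u w)) ⟩
    Σℚ n (λ u → Σℚ n (λ w → Σℚ k (λ U → Σℚ k (λ W → weighted u w U W))))
      ≡⟨ Σ-cong n (λ u → Σ-comm n k (λ w U → Σℚ k (weighted u w U))) ⟩
    Σℚ n (λ u → Σℚ k (λ U → Σℚ n (λ w → Σℚ k (weighted u w U))))
      ≡⟨ Σ-comm n k (λ u U → Σℚ n (λ w → Σℚ k (weighted u w U))) ⟩
    Σℚ k (λ U → Σℚ n (λ u → Σℚ n (λ w → Σℚ k (weighted u w U))))
      ≡⟨ Σ-cong k (λ U → Σ-cong n (λ u → Σ-comm n k (λ w → weighted u w U))) ⟩
    Σℚ k (λ U → Σℚ n (λ u → Σℚ k (λ W → Σℚ n (λ w → weighted u w U W))))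
      ≡⟨ Σ-cong k (λ U → Σ-comm n k (λ u W → Σℚ n (λ w → weighted u w U W))) ⟩
    Σℚ k (λ U → Σℚ k (λ W → blockΣ U W (λ u w → F u w U W)))
      ∎
    where
    open ≡-Reasoning
    weighted : Fin n → Fin n → Fin k → Fin k → ℚ
    weighted u w U W = (δ (p u) U * δ (p w) W) * F u w U W
    select : ∀ u w → F u w (p u) (p w) ≡ Σℚ k (λ U → Σℚ k (λ W → weighted u w U W))
    select u w = sym (begin
      Σℚ k (λ U → Σℚ k (λ W → weighted u w U W))
        ≡⟨ Σ-cong k (λ U → Σ-cong k (λ W → *-assoc (δ (p u) U) (δ (p w) W) _)) ⟩
      Σℚ k (λ U → Σℚ k (λ W → δ (p u) U * (δ (p w) W * F u w U W)))
        ≡⟨ Σ-cong k (λ U → sym (*-distribˡ-Σ k (δ (p u) U) _)) ⟩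
      Σℚ k (λ U → δ (p u) U * Σℚ k (λ W → δ (p w) W * F u w U W))
        ≡⟨ Σ-δ k (p u) _ ⟩
      Σℚ k (λ W → δ (p w) W * F u w (p u) W)
        ≡⟨ Σ-δ k (p w) _ ⟩
      F u w (p u) (p w)
        ∎)

  pairSize : Fin k → Fin k → ℕ
  pairSize U W = blockSize p U ℕ.* blockSize p W

  fromℕ-pairSize : ∀ U W → fromℕ (pairSize U W) ≡ blockΣ U W (λ _ _ → 1ℚ)
  fromℕ-pairSize U W = begin
    fromℕ (blockSize p U ℕ.* blockSize p W)
      ≡⟨ fromℕ-* (blockSize p U) (blockSize p W) ⟩
    fromℕ (blockSize p U) * fromℕ (blockSize p W)
      ≡⟨ cong₂ _*_ (size U) (size W) ⟩
    Σℚ n (λ u → δ (p u) U) * Σℚ n (λ w → δ (p w) W)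
      ≡⟨ *-distribʳ-Σ n _ _ ⟩
    Σℚ n (λ u → δ (p u) U * Σℚ n (λ w → δ (p w) W))
      ≡⟨ Σ-cong n (λ u → *-distribˡ-Σ n (δ (p u) U) _) ⟩
    Σℚ n (λ u → Σℚ n (λ w → δ (p u) U * δ (p w) W))
      ≡⟨ Σ-cong n (λ u → Σ-cong n (λ w → sym (*-identityʳ _))) ⟩
    blockΣ U W (λ _ _ → 1ℚ)
      ∎
    where
    open ≡-Reasoning
    size : ∀ U → fromℕ (blockSize p U) ≡ Σℚ n (λ u → δ (p u) U)
    size U = trans (fromℕ-Σ n _) (Σ-cong n (λ u → fromℕ-ind u U))

  blockΣ-cong : ∀ U W {X Y : Fin n → Fin n → ℚ} → (∀ u w → X u w ≡ Y u w) →
                blockΣ U W X ≡ blockΣ U W Y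
  blockΣ-cong U W X≡Y =
    Σ-cong n (λ u → Σ-cong n (λ w → cong (δ (p u) U * δ (p w) W *_) (X≡Y u w)))

  blockΣ-linear : ∀ U W c d (X Y : Fin n → Fin n → ℚ) →
                  blockΣ U W (λ u w → c * X u w + d * Y u w) ≡
                  c * blockΣ U W X + d * blockΣ U W Y
  blockΣ-linear U W c d X Y = begin
    Σℚ n (λ u → Σℚ n (λ w → m u w * (c * X u w + d * Y u w)))
      ≡⟨ Σ-cong n (λ u → Σ-cong n (λ w → distrib c d (m u w) (X u w) (Y u w))) ⟩
    Σℚ n (λ u → Σℚ n (λ w → c * (m u w * X u w) + d * (m u w * Y u w)))
      ≡⟨ Σ-cong n (λ u → Σ-distrib-+ n _ _) ⟩
    Σℚ n (λ u → Σℚ n (λ w → c * (m u w * X u w)) + Σℚ n (λ w → d * (m u w * Y u w)))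
      ≡⟨ Σ-distrib-+ n _ _ ⟩
    Σℚ n (λ u → Σℚ n (λ w → c * (m u w * X u w))) +
    Σℚ n (λ u → Σℚ n (λ w → d * (m u w * Y u w)))
      ≡⟨ sym (cong₂ _+_ (pull c (λ u w → m u w * X u w)) (pull d (λ u w → m u w * Y u w))) ⟩
    c * blockΣ U W X + d * blockΣ U W Y
      ∎
    where
    open ≡-Reasoning
    open +-*-Solver
    m : Fin n → Fin n → ℚ
    m u w = δ (p u) U * δ (p w) W
    distrib : ∀ c d m x y → m * (c * x + d * y) ≡ c * (m * x) + d * (m * y)
    distrib = solve 5 (λ c d m x y → m :* (c :* x :+ d :* y)
                                     := c :* (m :* x) :+ d :* (m :* y)) refl
    pull : ∀ c (F : Fin n → Fin n → ℚ) →
           c * Σℚ n (λ u → Σℚ n (F u)) ≡ Σℚ n (λ u → Σℚ n (λ w → c * F u w))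
    pull c F = trans (*-distribˡ-Σ n c _) (Σ-cong n (λ u → *-distribˡ-Σ n c (F u)))

  blockΣ-mono-≤ : ∀ U W {X Y : Fin n → Fin n → ℚ} → (∀ u w → X u w ≤ Y u w) →
                  blockΣ U W X ≤ blockΣ U W Y
  blockΣ-mono-≤ U W X≤Y = Σ-mono-≤ n (λ u → Σ-mono-≤ n (λ w →
    *-monoˡ-≤-nonNeg (δ (p u) U * δ (p w) W) {{nonNegative (weight-nonNeg u w)}} (X≤Y u w)))
    where
    weight-nonNeg : ∀ u w → 0ℚ ≤ δ (p u) U * δ (p w) W
    weight-nonNeg u w = 0≤p⇒0≤q⇒0≤p*q (δ-nonNeg (p u) U) (δ-nonNeg (p w) W)

module BlockErrors {n k : ℕ} (G : SimpleGraph n) (p : Fin n → Fin k) where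
  open Blocks p

  fromℕ-edgeSum : ∀ U W → fromℕ (edgeSum G p U W) ≡ blockΣ U W (A G)
  fromℕ-edgeSum U W = trans (fromℕ-Σ n row) (Σ-cong n (λ u →
    trans (fromℕ-Σ n (entryℕ u)) (Σ-cong n (λ w → entry u w))))
    where
    entryℕ : Fin n → Fin n → ℕ
    entryℕ u w = ind p u U ℕ.* ind p w W ℕ.* (if adj G u w then 1 else 0)
    row : Fin n → ℕ
    row u = Σℕ n (entryℕ u)
    entry : ∀ u w → fromℕ (entryℕ u w) ≡ (δ (p u) U * δ (p w) W) * A G u w
    entry u w = trans (fromℕ-* (ind p u U ℕ.* ind p w W) (if adj G u w then 1 else 0)) (cong₂ _*_
      (trans (fromℕ-* (ind p u U) (ind p w W)) (cong₂ _*_ (fromℕ-ind u U) (fromℕ-ind w W)))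
      (fromℕ-indicator (adj G u w)))

  edgeSum≤pairSize : ∀ U W → fromℕ (edgeSum G p U W) ≤ fromℕ (pairSize U W)
  edgeSum≤pairSize U W = subst₂ _≤_ (sym (fromℕ-edgeSum U W)) (sym (fromℕ-pairSize U W))
    (blockΣ-mono-≤ U W (λ u w → indicator≤1 (adj G u w)))

  α-unitInterval : ∀ U W → 0ℚ ≤ α G p U W × α G p U W ≤ 1ℚ
  α-unitInterval U W = divℕ-unitInterval (edgeSum G p U W) (pairSize U W) (edgeSum≤pairSize U W)

  blockError : Fin k → Fin k → ℚ
  blockError U W = blockΣ U W (λ u w → ∣ A G u w - α G p U W ∣)

  blockError≡pairSize*gini : ∀ U W → blockError U W ≡ fromℕ (pairSize U W) * gini (α G p U W)
  blockError≡pairSize*gini U W = begin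
    blockError U W
      ≡⟨ blockΣ-cong U W (λ u w →
           trans (∣indicator-x∣ (adj G u w) 0≤x x≤1) (affine x (A G u w))) ⟩
    blockΣ U W (λ u w → x * 1ℚ + (1ℚ - x - x) * A G u w)
      ≡⟨ blockΣ-linear U W x (1ℚ - x - x) (λ _ _ → 1ℚ) (A G) ⟩
    x * blockΣ U W (λ _ _ → 1ℚ) + (1ℚ - x - x) * blockΣ U W (A G)
      ≡⟨ sym (cong₂ (λ s t → x * s + (1ℚ - x - x) * t)
                    (fromℕ-pairSize U W) (fromℕ-edgeSum U W)) ⟩
    x * M + (1ℚ - x - x) * fromℕ (edgeSum G p U W)
      ≡⟨ cong (λ t → x * M + (1ℚ - x - x) * t) (sym M*x≡e) ⟩
    x * M + (1ℚ - x - x) * (M * x)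
      ≡⟨ collect x M ⟩
    M * gini x
      ∎
    where
    open ≡-Reasoning
    open +-*-Solver
    x M : ℚ
    x = α G p U W
    M = fromℕ (pairSize U W)
    0≤x : 0ℚ ≤ x
    0≤x = proj₁ (α-unitInterval U W)
    x≤1 : x ≤ 1ℚ
    x≤1 = proj₂ (α-unitInterval U W)
    M*x≡e : M * x ≡ fromℕ (edgeSum G p U W)
    M*x≡e = divℕ-inverse (edgeSum G p U W) (pairSize U W) (edgeSum≤pairSize U W)
    affine : ∀ x a → x + a * (1ℚ - x - x) ≡ x * 1ℚ + (1ℚ - x - x) * a
    affine = solve 2 (λ x a → x :+ a :* (con 1ℚ :- x :- x)
                              := x :* con 1ℚ :+ (con 1ℚ :- x :- x) :* a) refl
    collect : ∀ x M → x * M + (1ℚ - x - x) * (M * x) ≡ M * gini x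
    collect = solve 2 (λ x M → x :* M :+ (con 1ℚ :- x :- x) :* (M :* x)
                               := M :* ((x :+ x) :* (con 1ℚ :- x))) refl

  blockCorrections : Fin k → Fin k → ℚ
  blockCorrections U W = fromℕ (pairSize U W) * cost (α G p U W)

  blockCorrections≤blockError : ∀ U W → blockCorrections U W ≤ blockError U W
  blockCorrections≤blockError U W =
    subst (blockCorrections U W ≤_) (sym (blockError≡pairSize*gini U W))
      (*-monoˡ-≤-nonNeg (fromℕ (pairSize U W)) {{nonNegative (fromℕ-nonNeg (pairSize U W))}}
        (cost≤gini (proj₁ (α-unitInterval U W)) (proj₂ (α-unitInterval U W))))

  blockError≤2blockCorrections : ∀ U W →
                                 blockError U W ≤ blockCorrections U W + blockCorrections U W
  blockError≤2blockCorrections U W =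
    subst₂ _≤_ (sym (blockError≡pairSize*gini U W)) (*-distribˡ-+ (fromℕ (pairSize U W)) _ _)
      (*-monoˡ-≤-nonNeg (fromℕ (pairSize U W)) {{nonNegative (fromℕ-nonNeg (pairSize U W))}}
        (gini≤2cost (proj₁ (α-unitInterval U W)) (proj₂ (α-unitInterval U W))))

  correctionMass : ℚ
  correctionMass = Σℚ k (λ U → Σℚ k (blockCorrections U))

  RE₁≡Σ-blockError : RE₁ G p ≡ Σℚ k (λ U → Σℚ k (blockError U))
  RE₁≡Σ-blockError = Σ-by-blocks (λ u w U W → ∣ A G u w - α G p U W ∣)

  correctionMass≤RE₁ : correctionMass ≤ RE₁ G p
  correctionMass≤RE₁ = subst (correctionMass ≤_) (sym RE₁≡Σ-blockError)
    (Σ-mono-≤ k (λ U → Σ-mono-≤ k (blockCorrections≤blockError U)))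

  RE₁≤2correctionMass : RE₁ G p ≤ correctionMass + correctionMass
  RE₁≤2correctionMass = subst₂ _≤_ (sym RE₁≡Σ-blockError)
    (trans (Σ-cong k (λ U → Σ-distrib-+ k _ _)) (Σ-distrib-+ k _ _))
    (Σ-mono-≤ k (λ U → Σ-mono-≤ k (blockError≤2blockCorrections U)))

lemma1 : (n k : ℕ) → k ≥ 1 → (G : SimpleGraph n) →
         (P⁺ P* : Fin n → Fin k) →
         IsKPartition P⁺ →
         (∀ (Q : Fin n → Fin k) → IsKPartition Q → RE₁ G P⁺ ≤ RE₁ G Q) →
         IsKPartition P* →
         (∀ (Q : Fin n → Fin k) → IsKPartition Q → C G P* ≤ C G Q) →
         C G P⁺ ≤ ((+ 2) / 1) * C G P*
lemma1 n k _ G P⁺ P* _ RE₁-minimal P*-partition _ = begin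
  C G P⁺                  ≡⟨⟩
  ½ * X P⁺                ≤⟨ ½*-mono (correctionMass≤RE₁ P⁺) ⟩
  ½ * RE₁ G P⁺            ≤⟨ ½*-mono (RE₁-minimal P* P*-partition) ⟩
  ½ * RE₁ G P*            ≤⟨ ½*-mono (RE₁≤2correctionMass P*) ⟩
  ½ * (X P* + X P*)       ≡⟨ halve (X P*) ⟩
  ((+ 2) / 1) * C G P*    ∎
  where
  open BlockErrors G
  open ≤-Reasoning
  open +-*-Solver
  X : (Fin n → Fin k) → ℚ
  X = correctionMass
  ½*-mono : ∀ {p q} → p ≤ q → ½ * p ≤ ½ * q
  ½*-mono = *-monoˡ-≤-nonNeg ½
  halve : ∀ x → ½ * (x + x) ≡ ((+ 2) / 1) * (½ * x)
  halve = solve 1 (λ x → con ½ :* (x :+ x) := con ((+ 2) / 1) :* (con ½ :* x)) refl
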